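{- Let $r\geq2$ be an integer. For every $n\geq1$, $$\sum_{\substack{\lambda\vdash n\\ \omega_n(\lambda)>L(n)}}p(\lambda)^r\leq\frac{1}{n^{3(r-1)}},$$ where $L(n)=\log_2(2n^3)$.
   Context: A partition $\lambda\vdash n$ is a vector $(\lambda_1,\dots,\lambda_n)$ of nonnegative integers with $\sum_{j=1}^n j\lambda_j=n$. $p(\lambda)=\prod_{j=1}^n\frac{1}{j^{\lambda_j}\lambda_j!}$ (the probability that a uniformly random permutation of $n$ letters has cycle structure $\lambda$, so $\sum_{\lambda\vdash n}p(\lambda)=1$). $\omega_n(\lambda)=\sum_j\lambda_j$ is the number of cycles. $\log_2$ is the base-2 logarithm. -}

module Defs where

open import Data.Nat using (ℕ; zero; suc; _+_; _*_; _^_; _<_; NonZero; _!)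
open import Data.Nat.Properties using (_≟_; m*n≢0; m^n≢0; _!≢0)
open import Data.Vec using (Vec; []; _∷_)
open import Data.List using (List; []; _∷_; map; concatMap; upTo; filter; foldr)
open import Data.Integer using (+_)
open import Data.Rational using (ℚ; _/_; 0ℚ; 1ℚ) renaming (_+_ to _+ℚ_; _*_ to _*ℚ_)
open import Relation.Binary.PropositionalEquality using (_≡_)

-- A partition λ ⊢ n is a vector (λ₁,…,λₙ) : Vec ℕ n with Σ j λⱼ = n.
-- Entry at position i (0-based) is λ_{i+1}, the number of cycles of length i+1.

weightFrom : ∀ {k} → ℕ → Vec ℕ k → ℕ
weightFrom s []      = 0
weightFrom s (x ∷ v) = s * x + weightFrom (suc s) v

weight : ∀ {k} → Vec ℕ k → ℕ
weight = weightFrom 1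

ω : ∀ {k} → Vec ℕ k → ℕ
ω []      = 0
ω (x ∷ v) = x + ω v

boundedVecs : (k b : ℕ) → List (Vec ℕ k)
boundedVecs zero    b = [] ∷ []
boundedVecs (suc k) b = concatMap (λ x → map (x ∷_) (boundedVecs k b)) (upTo (suc b))

-- The list of all partitions λ ⊢ n (each λ_j ≤ n necessarily, since j ≥ 1)
partitions : (n : ℕ) → List (Vec ℕ n)
partitions n = filter (λ v → weight v ≟ n) (boundedVecs n n)

denFrom : ∀ {k} → (s : ℕ) → Vec ℕ k → ℕ
denFrom s []      = 1
denFrom s (x ∷ v) = (s ^ x * x !) * denFrom (suc s) v

denFrom≢0 : ∀ {k} (s : ℕ) → .{{NonZero s}} → (v : Vec ℕ k) → NonZero (denFrom s v)
denFrom≢0 s []      = _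
denFrom≢0 s (x ∷ v) =
  let instance _ = m^n≢0 s x
               _ = x !≢0
               _ = m*n≢0 (s ^ x) (x !)
               _ = denFrom≢0 (suc s) v
  in m*n≢0 (s ^ x * x !) (denFrom (suc s) v)

p : ∀ {k} → Vec ℕ k → ℚ
p v = ((+ 1) / denFrom 1 v) {{denFrom≢0 1 v}}

_^ℚ_ : ℚ → ℕ → ℚ
q ^ℚ zero  = 1ℚ
q ^ℚ suc r = q *ℚ (q ^ℚ r)

sumℚ : List ℚ → ℚ
sumℚ = foldr _+ℚ_ 0ℚ

-- Write D(λ) = ∏_j j^{λ_j} λ_j!, so that p(λ) = 1/D(λ). As j^{λ_j} λ_j! ≥ 2^{λ_j} for j ≥ 2 and
-- λ₁! ≥ 2^{λ₁−1}, we have 2^{ω(λ)} ≤ 2 D(λ); hence ω(λ) > log₂(2N) forces p(λ) < 1/N and so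
-- p(λ)^{r+1} ≤ N^{−r} p(λ). It remains to show Σ_{λ ⊢ n} p(λ) ≤ 1, which follows by strong
-- induction from the cycle-index recurrence m Σ_{λ ⊢ m} p(λ) = Σ_{j=1}^{m} Σ_{μ ⊢ m−j} p(μ),
-- obtained by splitting m = Σ_j j λ_j and removing one j-cycle from λ.
{-# OPTIONS --safe #-}
module Submission where

open import Defs
open import Data.Nat using (ℕ; _*_; _^_; _∸_; _≤_; _<_; NonZero; _<?_)
open import Data.Nat.Properties using (m^n≢0)
open import Data.List using (map; filter)
open import Data.Integer using (+_)
open import Data.Rational using (_/_) renaming (_≤_ to _≤ℚ_)

open import Algebra.Bundles using (CommutativeRing)
open import Data.Empty using (⊥-elim)
open import Data.Fin using (Fin; zero; suc; toℕ; inject₁; fromℕ)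
import Data.Fin.Properties as Fin
import Data.Integer as ℤ
import Data.Integer.Properties as ℤ
open import Data.List using (List; []; _∷_; _++_; concatMap; applyUpTo; upTo)
import Data.List.Properties as List
open import Data.Nat using (zero; suc; s≤s; z≤n; _+_; _≤?_; _!)
open import Data.Nat.Induction using (<-rec)
open import Data.Nat.Properties using (_≟_)
import Data.Nat.Properties as ℕ
open import Data.Nat.Solver using () renaming (module +-*-Solver to ℕ-Solver)
open ℕ-Solver using () renaming (solve to ℕ-solve; _:*_ to _:×_; _:=_ to _:=ℕ_; con to ℕ-con)
open import Data.Rational using (ℚ; 0ℚ; 1ℚ; toℚᵘ; nonNegative) renaming (_+_ to _+ℚ_; _*_ to _*ℚ_)
import Data.Rational.Properties as ℚ
open import Data.Rational.Solver using (module +-*-Solver)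
open +-*-Solver using (solve; _:+_; _:*_; _:=_; con)
open import Data.Rational.Unnormalised using (mkℚᵘ; *≡*; *≤*) renaming (_≃_ to _≃ᵘ_)
import Data.Rational.Unnormalised.Properties as ℚᵘ
open import Data.Vec using (Vec; []; _∷_)
open import Function using (_∘_; id)
open import Level using (0ℓ)
open import Relation.Binary.PropositionalEquality
open import Relation.Nullary using (Dec; yes; no)
open import Relation.Unary using (Pred; Decidable)

open import Algebra.Properties.Semiring.Sum (CommutativeRing.semiring ℚ.+-*-commutativeRing)
  using (sum; sum-syntax; sum-cong-≗; ∑-distrib-+; ∑-comm; sum-init-last; *-distribˡ-sum; sum-replicate-zero)

private
  variable
    A : Set

ℕ→ℚ : ℕ → ℚ
ℕ→ℚ n = + n / 1

1/ℕ : ℕ → ℚ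
1/ℕ zero    = 0ℚ
1/ℕ (suc n) = + 1 / suc n

private
  toℚᵘ-/ : ∀ a d → toℚᵘ (+ a / suc d) ≃ᵘ mkℚᵘ (+ a) d
  toℚᵘ-/ a d = ℚ.toℚᵘ-fromℚᵘ (mkℚᵘ (+ a) d)

ℕ→ℚ-+ : ∀ a b → ℕ→ℚ (a + b) ≡ ℕ→ℚ a +ℚ ℕ→ℚ b
ℕ→ℚ-+ a b = ℚ.toℚᵘ-injective (ℚᵘ.≃-trans (toℚᵘ-/ (a + b) 0) (ℚᵘ.≃-sym
  (ℚᵘ.≃-trans (ℚ.toℚᵘ-homo-+ (ℕ→ℚ a) (ℕ→ℚ b)) (ℚᵘ.≃-trans (ℚᵘ.+-cong (toℚᵘ-/ a 0) (toℚᵘ-/ b 0))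
    (*≡* (cong (ℤ._* + 1) (trans (cong₂ ℤ._+_ (ℤ.*-identityʳ (+ a)) (ℤ.*-identityʳ (+ b))) (sym (ℤ.pos-+ a b)))))))))

1/ℕ-* : ∀ a b → 1/ℕ (a * b) ≡ 1/ℕ a *ℚ 1/ℕ b
1/ℕ-* zero    b       = sym (ℚ.*-zeroˡ (1/ℕ b))
1/ℕ-* (suc a) zero    = trans (cong 1/ℕ (ℕ.*-zeroʳ a)) (sym (ℚ.*-zeroʳ (1/ℕ (suc a))))
1/ℕ-* (suc a) (suc b) = ℚ.toℚᵘ-injective (ℚᵘ.≃-trans (toℚᵘ-/ 1 (b + a * suc b)) (ℚᵘ.≃-sym
  (ℚᵘ.≃-trans (ℚ.toℚᵘ-homo-* (1/ℕ (suc a)) (1/ℕ (suc b))) (ℚᵘ.*-cong (toℚᵘ-/ 1 a) (toℚᵘ-/ 1 b)))))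

ℕ→ℚ*1/ℕ : ∀ n .{{_ : NonZero n}} → ℕ→ℚ n *ℚ 1/ℕ n ≡ 1ℚ
ℕ→ℚ*1/ℕ (suc n) = ℚ.toℚᵘ-injective (ℚᵘ.≃-trans (ℚ.toℚᵘ-homo-* (ℕ→ℚ (suc n)) (1/ℕ (suc n)))
  (ℚᵘ.≃-trans (ℚᵘ.*-cong (toℚᵘ-/ (suc n) 0) (toℚᵘ-/ 1 n)) (ℚᵘ.*-inverseʳ (mkℚᵘ (+ suc n) 0))))

ℕ→ℚ-nonNeg : ∀ n → 0ℚ ≤ℚ ℕ→ℚ n
ℕ→ℚ-nonNeg n = ℚ.toℚᵘ-cancel-≤ (ℚᵘ.≤-respʳ-≃ (ℚᵘ.≃-sym (toℚᵘ-/ n 0)) (ℚᵘ.nonNegative⁻¹ _))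

1/ℕ-nonNeg : ∀ n → 0ℚ ≤ℚ 1/ℕ n
1/ℕ-nonNeg zero    = ℚ.≤-refl
1/ℕ-nonNeg (suc n) = ℚ.toℚᵘ-cancel-≤ (ℚᵘ.≤-respʳ-≃ (ℚᵘ.≃-sym (toℚᵘ-/ 1 n)) (ℚᵘ.nonNegative⁻¹ _))

1/ℕ-antimono : ∀ {a b} .{{_ : NonZero b}} → b ≤ a → 1/ℕ a ≤ℚ 1/ℕ b
1/ℕ-antimono {suc a} {suc b} b≤a = ℚ.toℚᵘ-cancel-≤
  (ℚᵘ.≤-respʳ-≃ (ℚᵘ.≃-sym (toℚᵘ-/ 1 b)) (ℚᵘ.≤-respˡ-≃ (ℚᵘ.≃-sym (toℚᵘ-/ 1 a))
    (*≤* (ℤ.*-monoˡ-≤-nonNeg (+ 1) (ℤ.+≤+ b≤a)))))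

1/ℕ-^ : ∀ n r → 1/ℕ n ^ℚ r ≡ 1/ℕ (n ^ r)
1/ℕ-^ n zero    = refl
1/ℕ-^ n (suc r) = trans (cong (1/ℕ n *ℚ_) (1/ℕ-^ n r)) (sym (1/ℕ-* n (n ^ r)))

1/-≡-1/ℕ : ∀ n .{{_ : NonZero n}} → + 1 / n ≡ 1/ℕ n
1/-≡-1/ℕ (suc n) = refl

ℕ→ℚ-*-≤-cancel : ∀ n .{{_ : NonZero n}} {q} → ℕ→ℚ n *ℚ q ≤ℚ ℕ→ℚ n → q ≤ℚ 1ℚ
ℕ→ℚ-*-≤-cancel n {q} nq≤n = begin
  q                               ≡⟨ ℚ.*-identityˡ q ⟨
  1ℚ *ℚ q                         ≡⟨ cong (_*ℚ q) (trans (ℚ.*-comm (1/ℕ n) (ℕ→ℚ n)) (ℕ→ℚ*1/ℕ n)) ⟨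
  (1/ℕ n *ℚ ℕ→ℚ n) *ℚ q           ≡⟨ ℚ.*-assoc (1/ℕ n) (ℕ→ℚ n) q ⟩
  1/ℕ n *ℚ (ℕ→ℚ n *ℚ q)           ≤⟨ ℚ.*-monoˡ-≤-nonNeg (1/ℕ n) {{nonNegative (1/ℕ-nonNeg n)}} nq≤n ⟩
  1/ℕ n *ℚ ℕ→ℚ n                  ≡⟨ trans (ℚ.*-comm (1/ℕ n) (ℕ→ℚ n)) (ℕ→ℚ*1/ℕ n) ⟩
  1ℚ                              ∎
  where open ℚ.≤-Reasoning

*-nonNeg : ∀ {x y} → 0ℚ ≤ℚ x → 0ℚ ≤ℚ y → 0ℚ ≤ℚ x *ℚ y
*-nonNeg {x} {y} 0≤x 0≤y = ℚ.nonNegative⁻¹ (x *ℚ y) {{ℚ.nonNeg*nonNeg⇒nonNeg x {{nonNegative 0≤x}} y {{nonNegative 0≤y}}}}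

^ℚ-nonNeg : ∀ r {x} → 0ℚ ≤ℚ x → 0ℚ ≤ℚ x ^ℚ r
^ℚ-nonNeg zero    _   = ℚ.nonNegative⁻¹ 1ℚ
^ℚ-nonNeg (suc r) 0≤x = *-nonNeg 0≤x (^ℚ-nonNeg r 0≤x)

^ℚ-monoˡ-≤ : ∀ r {x y} → 0ℚ ≤ℚ x → x ≤ℚ y → x ^ℚ r ≤ℚ y ^ℚ r
^ℚ-monoˡ-≤ zero    _   _   = ℚ.≤-refl
^ℚ-monoˡ-≤ (suc r) {x} {y} 0≤x x≤y = begin
  x *ℚ x ^ℚ r      ≤⟨ ℚ.*-monoˡ-≤-nonNeg x {{nonNegative 0≤x}} (^ℚ-monoˡ-≤ r 0≤x x≤y) ⟩
  x *ℚ y ^ℚ r      ≤⟨ ℚ.*-monoʳ-≤-nonNeg (y ^ℚ r) {{nonNegative (^ℚ-nonNeg r (ℚ.≤-trans 0≤x x≤y))}} x≤y ⟩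
  y *ℚ y ^ℚ r      ∎
  where open ℚ.≤-Reasoning

when : {P : Set} → Dec P → ℚ → ℚ
when (yes _) q = q
when (no _)  _ = 0ℚ

when-cong : {P Q : Set} (p? : Dec P) (q? : Dec Q) → (P → Q) → (Q → P) →
            ∀ {x y} → x ≡ y → when p? x ≡ when q? y
when-cong (yes _) (yes _)  _ _ x≡y = x≡y
when-cong (no _)  (no _)   _ _ _   = refl
when-cong (yes p) (no ¬q)  f _ _   = ⊥-elim (¬q (f p))
when-cong (no ¬p) (yes q)  _ g _   = ⊥-elim (¬p (g q))

*-when : {P : Set} (p? : Dec P) → ∀ c x → c *ℚ when p? x ≡ when p? (c *ℚ x)
*-when (yes _) c x = refl
*-when (no _)  c x = ℚ.*-zeroʳ c

∑-when : {P : Set} (p? : Dec P) → ∀ {n} (f : Fin n → ℚ) → ∑[ i < n ] when p? (f i) ≡ when p? (sum f)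
∑-when (yes _) f = refl
∑-when (no _) {n} f = sum-replicate-zero n

sumℚ-++ : ∀ xs ys → sumℚ (xs ++ ys) ≡ sumℚ xs +ℚ sumℚ ys
sumℚ-++ []       ys = sym (ℚ.+-identityˡ _)
sumℚ-++ (x ∷ xs) ys = trans (cong (x +ℚ_) (sumℚ-++ xs ys)) (sym (ℚ.+-assoc x _ _))

sumℚ-concatMap : (f : A → ℚ) (g : ℕ → List A) → ∀ xs →
                 sumℚ (map f (concatMap g xs)) ≡ sumℚ (map (λ x → sumℚ (map f (g x))) xs)
sumℚ-concatMap f g []       = refl
sumℚ-concatMap f g (x ∷ xs) = begin
  sumℚ (map f (g x ++ concatMap g xs))                   ≡⟨ cong sumℚ (List.map-++ f (g x) _) ⟩
  sumℚ (map f (g x) ++ map f (concatMap g xs))           ≡⟨ sumℚ-++ (map f (g x)) _ ⟩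
  sumℚ (map f (g x)) +ℚ sumℚ (map f (concatMap g xs))    ≡⟨ cong (sumℚ (map f (g x)) +ℚ_) (sumℚ-concatMap f g xs) ⟩
  sumℚ (map f (g x)) +ℚ sumℚ (map (λ y → sumℚ (map f (g y))) xs) ∎
  where open ≡-Reasoning

sumℚ-*ˡ : (f : A → ℚ) → ∀ c xs → sumℚ (map (λ x → c *ℚ f x) xs) ≡ c *ℚ sumℚ (map f xs)
sumℚ-*ˡ f c []       = sym (ℚ.*-zeroʳ c)
sumℚ-*ˡ f c (x ∷ xs) = trans (cong (c *ℚ f x +ℚ_) (sumℚ-*ˡ f c xs)) (sym (ℚ.*-distribˡ-+ c (f x) _))

sumℚ-when : {P : Set} (p? : Dec P) (f : A → ℚ) → ∀ xs → sumℚ (map (λ x → when p? (f x)) xs) ≡ when p? (sumℚ (map f xs))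
sumℚ-when (yes _) f xs       = refl
sumℚ-when (no ¬p) f []       = refl
sumℚ-when (no ¬p) f (x ∷ xs) = trans (ℚ.+-identityˡ _) (sumℚ-when (no ¬p) f xs)

sumℚ-upTo : (h : ℕ → ℚ) → ∀ n → sumℚ (map h (upTo n)) ≡ ∑[ i < n ] h (toℕ i)
sumℚ-upTo h n = trans (cong sumℚ (List.map-applyUpTo id h n)) (sumℚ-applyUpTo h n)
  where
  sumℚ-applyUpTo : (h : ℕ → ℚ) → ∀ n → sumℚ (applyUpTo h n) ≡ ∑[ i < n ] h (toℕ i)
  sumℚ-applyUpTo h zero    = refl
  sumℚ-applyUpTo h (suc n) = cong (h 0 +ℚ_) (sumℚ-applyUpTo (h ∘ suc) n)

sumℚ-filter : {P : Pred A 0ℓ} (P? : Decidable P) (f : A → ℚ) → ∀ xs →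
              sumℚ (map f (filter P? xs)) ≡ sumℚ (map (λ x → when (P? x) (f x)) xs)
sumℚ-filter P? f []       = refl
sumℚ-filter P? f (x ∷ xs) with P? x
... | yes _ = cong (f x +ℚ_) (sumℚ-filter P? f xs)
... | no _  = trans (sumℚ-filter P? f xs) (sym (ℚ.+-identityˡ _))

sumℚ-mono : {f g : A → ℚ} → (∀ x → f x ≤ℚ g x) → ∀ xs → sumℚ (map f xs) ≤ℚ sumℚ (map g xs)
sumℚ-mono f≤g []       = ℚ.≤-refl
sumℚ-mono f≤g (x ∷ xs) = ℚ.+-mono-≤ (f≤g x) (sumℚ-mono f≤g xs)

∑-≤-support : ∀ {n} (f : Fin n → ℚ) m → (∀ i → f i ≤ℚ 1ℚ) → (∀ i → m ≤ toℕ i → f i ≡ 0ℚ) →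
              sum f ≤ℚ ℕ→ℚ m
∑-≤-support {zero}  f m       _   _    = ℕ→ℚ-nonNeg m
∑-≤-support {suc n} f zero    f≤1 f₀≡0 = begin
  f zero +ℚ sum (f ∘ suc)   ≡⟨ cong (_+ℚ sum (f ∘ suc)) (f₀≡0 zero z≤n) ⟩
  0ℚ +ℚ sum (f ∘ suc)       ≡⟨ ℚ.+-identityˡ _ ⟩
  sum (f ∘ suc)             ≤⟨ ∑-≤-support (f ∘ suc) 0 (f≤1 ∘ suc) (λ i _ → f₀≡0 (suc i) z≤n) ⟩
  0ℚ                        ∎
  where open ℚ.≤-Reasoning
∑-≤-support {suc n} f (suc m) f≤1 f≡0 = begin
  f zero +ℚ sum (f ∘ suc)   ≤⟨ ℚ.+-mono-≤ (f≤1 zero) (∑-≤-support (f ∘ suc) m (f≤1 ∘ suc) (λ i m≤i → f≡0 (suc i) (s≤s m≤i))) ⟩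
  1ℚ +ℚ ℕ→ℚ m              ≡⟨ ℕ→ℚ-+ 1 m ⟨
  ℕ→ℚ (suc m)              ∎
  where open ℚ.≤-Reasoning

cycleFactor : ℕ → ℕ → ℚ
cycleFactor s x = 1/ℕ (s ^ x * x !)

ℕ→ℚ-*-cycleFactor : ∀ s y .{{_ : NonZero s}} → ℕ→ℚ (s * suc y) *ℚ cycleFactor s (suc y) ≡ cycleFactor s y
ℕ→ℚ-*-cycleFactor s y = begin
  ℕ→ℚ sy *ℚ 1/ℕ (s ^ suc y * suc y !)          ≡⟨ cong (λ d → ℕ→ℚ sy *ℚ 1/ℕ d) regroup ⟩
  ℕ→ℚ sy *ℚ 1/ℕ (sy * (s ^ y * y !))           ≡⟨ cong (ℕ→ℚ sy *ℚ_) (1/ℕ-* sy (s ^ y * y !)) ⟩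
  ℕ→ℚ sy *ℚ (1/ℕ sy *ℚ cycleFactor s y)        ≡⟨ ℚ.*-assoc (ℕ→ℚ sy) (1/ℕ sy) _ ⟨
  (ℕ→ℚ sy *ℚ 1/ℕ sy) *ℚ cycleFactor s y        ≡⟨ cong (_*ℚ cycleFactor s y) (ℕ→ℚ*1/ℕ sy {{ℕ.m*n≢0 s (suc y)}}) ⟩
  1ℚ *ℚ cycleFactor s y                        ≡⟨ ℚ.*-identityˡ _ ⟩
  cycleFactor s y                              ∎
  where
  open ≡-Reasoning
  sy : ℕ
  sy = s * suc y
  regroup : s ^ suc y * suc y ! ≡ sy * (s ^ y * y !)
  regroup = ℕ-solve 4 (λ s p y f → (s :× p) :× (y :× f) :=ℕ (s :× y) :× (p :× f)) refl s (s ^ y) (suc y) (y !)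

-- Σ p(λ) over the λ ⊢ m using only cycle lengths s, …, s+k−1, each at most b times.
mass : (b s k m : ℕ) → ℚ
mass b s k m = sumℚ (map (λ v → when (weightFrom s v ≟ m) (1/ℕ (denFrom s v))) (boundedVecs k b))

-- f (m − j), with the value 0 (rather than f 0) when j > m.
atDiff : (ℕ → ℚ) → ℕ → ℕ → ℚ
atDiff f m j = when (j ≤? m) (f (m ∸ j))

atDiff-cong : ∀ {f g} m j → (∀ m′ → m′ + j ≡ m → f m′ ≡ g m′) → atDiff f m j ≡ atDiff g m j
atDiff-cong m j f≡g with j ≤? m
... | yes j≤m = f≡g (m ∸ j) (ℕ.m∸n+n≡m j≤m)
... | no _    = refl

*-atDiff : ∀ c f m j → c *ℚ atDiff f m j ≡ atDiff (λ m′ → c *ℚ f m′) m j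
*-atDiff c f m j = *-when (j ≤? m) c (f (m ∸ j))

∑-atDiff : ∀ {n} (f : Fin n → ℕ → ℚ) m j → ∑[ i < n ] atDiff (f i) m j ≡ atDiff (λ m′ → ∑[ i < n ] f i m′) m j
∑-atDiff f m j = ∑-when (j ≤? m) (λ i → f i (m ∸ j))

atDiff-+ : ∀ f m a j → atDiff (λ m′ → atDiff f m′ j) m a ≡ atDiff f m (a + j)
atDiff-+ f m a j with a ≤? m | j ≤? m ∸ a | a + j ≤? m
... | yes _   | yes _   | yes _    = cong f (ℕ.∸-+-assoc m a j)
... | yes _   | no _    | no _     = refl
... | no _    | _       | no _     = refl
... | yes a≤m | yes j≤  | no a+j≰m = ⊥-elim (a+j≰m (subst (_≤ m) (ℕ.+-comm j a) (ℕ.m≤o∸n⇒m+n≤o j a≤m j≤)))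
... | yes _   | no j≰   | yes a+j≤m = ⊥-elim (j≰ (ℕ.m+n≤o⇒m≤o∸n j (subst (_≤ m) (ℕ.+-comm a j) a+j≤m)))
... | no a≰m  | _       | yes a+j≤m = ⊥-elim (a≰m (ℕ.≤-trans (ℕ.m≤m+n a j) a+j≤m))

atDiff-comm : ∀ f m a j → atDiff (λ m′ → atDiff f m′ j) m a ≡ atDiff (λ m′ → atDiff f m′ a) m j
atDiff-comm f m a j = trans (atDiff-+ f m a j) (trans (cong (atDiff f m) (ℕ.+-comm a j)) (sym (atDiff-+ f m j a)))

ℕ→ℚ-*-atDiff : ∀ c f m j →
  ℕ→ℚ m *ℚ (c *ℚ atDiff f m j) ≡ c *ℚ (ℕ→ℚ (m ∸ j) *ℚ atDiff f m j) +ℚ (ℕ→ℚ j *ℚ c) *ℚ atDiff f m j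
ℕ→ℚ-*-atDiff c f m j with j ≤? m
... | yes j≤m = trans (cong (λ n → ℕ→ℚ n *ℚ (c *ℚ f (m ∸ j))) (sym (ℕ.m∸n+n≡m j≤m)))
  (trans (cong (_*ℚ (c *ℚ f (m ∸ j))) (ℕ→ℚ-+ (m ∸ j) j))
    (solve 4 (λ a d c x → (a :+ d) :* (c :* x) := c :* (a :* x) :+ (d :* c) :* x) refl (ℕ→ℚ (m ∸ j)) (ℕ→ℚ j) c (f (m ∸ j))))
... | no _    = solve 4 (λ n c a d → n :* (c :* con 0ℚ) := c :* (a :* con 0ℚ) :+ (d :* c) :* con 0ℚ) refl (ℕ→ℚ m) c (ℕ→ℚ (m ∸ j)) (ℕ→ℚ j)

+≡⇒≡∸ : ∀ {a w m} → a + w ≡ m → w ≡ m ∸ a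
+≡⇒≡∸ {a} {w} a+w≡m = trans (sym (ℕ.m+n∸m≡n a w)) (cong (_∸ a) a+w≡m)

mass-summand-∷ : ∀ s m x {k} (v : Vec ℕ k) →
  when (weightFrom s (x ∷ v) ≟ m) (1/ℕ (denFrom s (x ∷ v)))
    ≡ cycleFactor s x *ℚ when (s * x ≤? m) (when (weightFrom (suc s) v ≟ m ∸ s * x) (1/ℕ (denFrom (suc s) v)))
mass-summand-∷ s m x v with s * x ≤? m
... | yes sx≤m = trans
  (when-cong (weightFrom s (x ∷ v) ≟ m) (weightFrom (suc s) v ≟ m ∸ s * x)
    +≡⇒≡∸ (λ w≡m∸sx → trans (cong (λ w → s * x + w) w≡m∸sx) (ℕ.m+[n∸m]≡n sx≤m))
    (1/ℕ-* (s ^ x * x !) (denFrom (suc s) v)))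
  (sym (*-when (weightFrom (suc s) v ≟ m ∸ s * x) (cycleFactor s x) _))
... | no sx≰m = trans
  (when-cong (weightFrom s (x ∷ v) ≟ m) (no sx≰m) (λ sx+w≡m → subst (s * x ≤_) sx+w≡m (ℕ.m≤m+n _ _)) (⊥-elim ∘ sx≰m) refl)
  (sym (ℚ.*-zeroʳ (cycleFactor s x)))

mass-∷ : ∀ b s k m →
  mass b s (suc k) m ≡ ∑[ x < suc b ] (cycleFactor s (toℕ x) *ℚ atDiff (mass b (suc s) k) m (s * toℕ x))
mass-∷ b s k m = begin
  mass b s (suc k) m                                               ≡⟨ sumℚ-concatMap summand row (upTo (suc b)) ⟩
  sumℚ (map (λ x → sumℚ (map summand (row x))) (upTo (suc b)))     ≡⟨ sumℚ-upTo (λ x → sumℚ (map summand (row x))) (suc b) ⟩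
  ∑[ x < suc b ] sumℚ (map summand (row (toℕ x)))                  ≡⟨ sum-cong-≗ {suc b} (row-mass ∘ toℕ) ⟩
  ∑[ x < suc b ] (cycleFactor s (toℕ x) *ℚ atDiff (mass b (suc s) k) m (s * toℕ x)) ∎
  where
  open ≡-Reasoning
  summand : Vec ℕ (suc k) → ℚ
  summand v = when (weightFrom s v ≟ m) (1/ℕ (denFrom s v))
  row : ℕ → List (Vec ℕ (suc k))
  row x = map (x ∷_) (boundedVecs k b)
  row-mass : ∀ x → sumℚ (map summand (row x)) ≡ cycleFactor s x *ℚ atDiff (mass b (suc s) k) m (s * x)
  row-mass x = begin
    sumℚ (map summand (row x))                          ≡⟨ cong sumℚ (List.map-∘ (boundedVecs k b)) ⟨
    sumℚ (map (summand ∘ (x ∷_)) (boundedVecs k b))     ≡⟨ cong sumℚ (List.map-cong (mass-summand-∷ s m x) (boundedVecs k b)) ⟩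
    sumℚ (map (λ v → cycleFactor s x *ℚ when d (summand′ v)) (boundedVecs k b))
                                                        ≡⟨ sumℚ-*ˡ (λ v → when d (summand′ v)) (cycleFactor s x) (boundedVecs k b) ⟩
    cycleFactor s x *ℚ sumℚ (map (λ v → when d (summand′ v)) (boundedVecs k b))
                                                        ≡⟨ cong (cycleFactor s x *ℚ_) (sumℚ-when d summand′ (boundedVecs k b)) ⟩
    cycleFactor s x *ℚ atDiff (mass b (suc s) k) m (s * x) ∎
    where
    d : Dec (s * x ≤ m)
    d = s * x ≤? m
    summand′ : Vec ℕ k → ℚ
    summand′ v = when (weightFrom (suc s) v ≟ m ∸ s * x) (1/ℕ (denFrom (suc s) v))

mass-∷-init : ∀ b s k m → m < s * b →
  mass b s (suc k) m ≡ ∑[ y < b ] (cycleFactor s (toℕ y) *ℚ atDiff (mass b (suc s) k) m (s * toℕ y))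
mass-∷-init b s k m m<sb = begin
  mass b s (suc k) m                                ≡⟨ mass-∷ b s k m ⟩
  ∑[ x < suc b ] term (toℕ x)                       ≡⟨ sum-init-last {b} (term ∘ toℕ) ⟩
  ∑[ y < b ] term (toℕ (inject₁ y)) +ℚ term (toℕ (fromℕ b))
                                                    ≡⟨ cong₂ _+ℚ_ (sum-cong-≗ {b} (cong term ∘ Fin.toℕ-inject₁))
                                                                  (trans (cong term (Fin.toℕ-fromℕ b)) top-term) ⟩
  ∑[ y < b ] term (toℕ y) +ℚ 0ℚ                     ≡⟨ ℚ.+-identityʳ _ ⟩
  ∑[ y < b ] term (toℕ y)                           ∎
  where
  open ≡-Reasoning
  term : ℕ → ℚ
  term x = cycleFactor s x *ℚ atDiff (mass b (suc s) k) m (s * x)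
  top-term : term b ≡ 0ℚ
  top-term with s * b ≤? m
  ... | yes sb≤m = ⊥-elim (ℕ.<⇒≱ m<sb sb≤m)
  ... | no _     = ℚ.*-zeroʳ (cycleFactor s b)

mass-zero : ∀ b t k → mass b (suc t) k 0 ≡ 1ℚ
mass-zero b t zero    = refl
mass-zero b t (suc k) = begin
  mass b s (suc k) 0                                              ≡⟨ mass-∷ b s k 0 ⟩
  cycleFactor s 0 *ℚ atDiff M′ 0 (s * 0) +ℚ ∑[ y < b ] (cycleFactor s (suc (toℕ y)) *ℚ 0ℚ)
                                                                  ≡⟨ cong₂ _+ℚ_ head-term (sum-cong-≗ {b} (ℚ.*-zeroʳ ∘ cycleFactor s ∘ suc ∘ toℕ)) ⟩
  1ℚ +ℚ ∑[ y < b ] 0ℚ                                             ≡⟨ cong (1ℚ +ℚ_) (sum-replicate-zero b) ⟩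
  1ℚ                                                              ∎
  where
  open ≡-Reasoning
  s : ℕ
  s = suc t
  M′ : ℕ → ℚ
  M′ = mass b (suc s) k
  head-term : cycleFactor s 0 *ℚ atDiff M′ 0 (s * 0) ≡ 1ℚ
  head-term = trans (ℚ.*-identityˡ _) (trans (cong (atDiff M′ 0) (ℕ.*-zeroʳ s)) (mass-zero b s k))

-- Removing one s-cycle: Σ_λ s λ_s p(λ) over λ ⊢ m is the mass of m − s, since (s x)·c_x = c_{x−1}.
firstLength-contribution : ∀ b t k m → m ≤ b →
  ∑[ x < suc b ] ((ℕ→ℚ (suc t * toℕ x) *ℚ cycleFactor (suc t) (toℕ x)) *ℚ atDiff (mass b (suc (suc t)) k) m (suc t * toℕ x))
    ≡ atDiff (mass b (suc t) (suc k)) m (suc t)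
firstLength-contribution b t k m m≤b = begin
  term 0 +ℚ ∑[ y < b ] term (suc (toℕ y))                        ≡⟨ cong₂ _+ℚ_ head-term (sum-cong-≗ {b} (shift ∘ toℕ)) ⟩
  0ℚ +ℚ ∑[ y < b ] (cycleFactor s (toℕ y) *ℚ atDiff (λ m′ → atDiff M′ m′ (s * toℕ y)) m s)
                                                                 ≡⟨ ℚ.+-identityˡ _ ⟩
  ∑[ y < b ] (cycleFactor s (toℕ y) *ℚ atDiff (λ m′ → atDiff M′ m′ (s * toℕ y)) m s)
                                                                 ≡⟨ sum-cong-≗ {b} (λ y → *-atDiff (cycleFactor s (toℕ y)) (λ m′ → atDiff M′ m′ (s * toℕ y)) m s) ⟩
  ∑[ y < b ] atDiff (λ m′ → cycleFactor s (toℕ y) *ℚ atDiff M′ m′ (s * toℕ y)) m s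
                                                                 ≡⟨ ∑-atDiff {b} (λ y m′ → cycleFactor s (toℕ y) *ℚ atDiff M′ m′ (s * toℕ y)) m s ⟩
  atDiff (λ m′ → ∑[ y < b ] (cycleFactor s (toℕ y) *ℚ atDiff M′ m′ (s * toℕ y))) m s
                                                                 ≡⟨ atDiff-cong m s (λ m′ m′+s≡m → sym (mass-∷-init b s k m′ (m′<sb m′+s≡m))) ⟩
  atDiff (mass b s (suc k)) m s                                  ∎
  where
  open ≡-Reasoning
  s : ℕ
  s = suc t
  M′ : ℕ → ℚ
  M′ = mass b (suc s) k
  term : ℕ → ℚ
  term x = (ℕ→ℚ (s * x) *ℚ cycleFactor s x) *ℚ atDiff M′ m (s * x)
  head-term : term 0 ≡ 0ℚ
  head-term = begin
    (ℕ→ℚ (s * 0) *ℚ cycleFactor s 0) *ℚ atDiff M′ m (s * 0) ≡⟨ cong (λ n → (ℕ→ℚ n *ℚ 1ℚ) *ℚ atDiff M′ m n) (ℕ.*-zeroʳ s) ⟩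
    (0ℚ *ℚ 1ℚ) *ℚ atDiff M′ m 0                             ≡⟨ ℚ.*-zeroˡ (atDiff M′ m 0) ⟩
    0ℚ                                                      ∎
  shift : ∀ y → term (suc y) ≡ cycleFactor s y *ℚ atDiff (λ m′ → atDiff M′ m′ (s * y)) m s
  shift y = cong₂ _*ℚ_ (ℕ→ℚ-*-cycleFactor s y)
                       (trans (cong (atDiff M′ m) (ℕ.*-suc s y)) (sym (atDiff-+ M′ m s (s * y))))
  m′<sb : ∀ {m′} → m′ + s ≡ m → m′ < s * b
  m′<sb {m′} m′+s≡m = ℕ.<-≤-trans (subst (m′ <_) m′+s≡m (ℕ.m<m+n m′ (s≤s z≤n))) (ℕ.≤-trans m≤b (ℕ.m≤n*m b s))

-- Σ_λ (m − s λ_s) p(λ) over λ ⊢ m, by the recurrence for the lengths s+1, …, s+k−1.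
otherLengths-contribution : ∀ b s k m → m ≤ b →
  (∀ m′ → m′ ≤ b → ℕ→ℚ m′ *ℚ mass b (suc s) k m′ ≡ ∑[ i < k ] atDiff (mass b (suc s) k) m′ (toℕ i + suc s)) →
  ∑[ x < suc b ] (cycleFactor s (toℕ x) *ℚ (ℕ→ℚ (m ∸ s * toℕ x) *ℚ atDiff (mass b (suc s) k) m (s * toℕ x)))
    ≡ ∑[ i < k ] atDiff (mass b s (suc k)) m (toℕ i + suc s)
otherLengths-contribution b s k m m≤b rec-M′ = begin
  ∑[ x < suc b ] (c x *ℚ (ℕ→ℚ (m ∸ s * toℕ x) *ℚ atDiff M′ m (s * toℕ x)))
                                                  ≡⟨ sum-cong-≗ {suc b} expand ⟩
  ∑[ x < suc b ] ∑[ i < k ] (c x *ℚ atDiff (λ m′ → atDiff M′ m′ (s * toℕ x)) m (toℕ i + suc s))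
                                                  ≡⟨ ∑-comm {suc b} {k} (λ x i → c x *ℚ atDiff (λ m′ → atDiff M′ m′ (s * toℕ x)) m (toℕ i + suc s)) ⟩
  ∑[ i < k ] ∑[ x < suc b ] (c x *ℚ atDiff (λ m′ → atDiff M′ m′ (s * toℕ x)) m (toℕ i + suc s))
                                                  ≡⟨ sum-cong-≗ {k} (λ i → collect (toℕ i + suc s)) ⟩
  ∑[ i < k ] atDiff (mass b s (suc k)) m (toℕ i + suc s) ∎
  where
  open ≡-Reasoning
  M′ : ℕ → ℚ
  M′ = mass b (suc s) k
  c : Fin (suc b) → ℚ
  c x = cycleFactor s (toℕ x)
  expand : ∀ x → c x *ℚ (ℕ→ℚ (m ∸ s * toℕ x) *ℚ atDiff M′ m (s * toℕ x))
                   ≡ ∑[ i < k ] (c x *ℚ atDiff (λ m′ → atDiff M′ m′ (s * toℕ x)) m (toℕ i + suc s))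
  expand x = begin
    c x *ℚ (ℕ→ℚ (m ∸ j) *ℚ atDiff M′ m j)                              ≡⟨ cong (c x *ℚ_) (trans (*-atDiff (ℕ→ℚ (m ∸ j)) M′ m j)
                                                                            (atDiff-cong m j (λ m′ m′+j≡m → rec-M′ m′ (ℕ.≤-trans (ℕ.m≤m+n m′ j) (subst (_≤ b) (sym m′+j≡m) m≤b))))) ⟩
    c x *ℚ atDiff (λ m′ → ∑[ i < k ] atDiff M′ m′ (toℕ i + suc s)) m j ≡⟨ cong (c x *ℚ_) (∑-atDiff {k} (λ i m′ → atDiff M′ m′ (toℕ i + suc s)) m j) ⟨
    c x *ℚ ∑[ i < k ] atDiff (λ m′ → atDiff M′ m′ (toℕ i + suc s)) m j ≡⟨ *-distribˡ-sum {k} (c x) (λ i → atDiff (λ m′ → atDiff M′ m′ (toℕ i + suc s)) m j) ⟩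
    ∑[ i < k ] (c x *ℚ atDiff (λ m′ → atDiff M′ m′ (toℕ i + suc s)) m j)
                                                                       ≡⟨ sum-cong-≗ {k} (λ i → cong (c x *ℚ_) (atDiff-comm M′ m j (toℕ i + suc s))) ⟩
    ∑[ i < k ] (c x *ℚ atDiff (λ m′ → atDiff M′ m′ j) m (toℕ i + suc s)) ∎
    where
      j : ℕ
      j = s * toℕ x
  collect : ∀ j → ∑[ x < suc b ] (c x *ℚ atDiff (λ m′ → atDiff M′ m′ (s * toℕ x)) m j) ≡ atDiff (mass b s (suc k)) m j
  collect j = begin
    ∑[ x < suc b ] (c x *ℚ atDiff (λ m′ → atDiff M′ m′ (s * toℕ x)) m j)  ≡⟨ sum-cong-≗ {suc b} (λ x → *-atDiff (c x) (λ m′ → atDiff M′ m′ (s * toℕ x)) m j) ⟩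
    ∑[ x < suc b ] atDiff (λ m′ → c x *ℚ atDiff M′ m′ (s * toℕ x)) m j    ≡⟨ ∑-atDiff {suc b} (λ x m′ → c x *ℚ atDiff M′ m′ (s * toℕ x)) m j ⟩
    atDiff (λ m′ → ∑[ x < suc b ] (c x *ℚ atDiff M′ m′ (s * toℕ x))) m j  ≡⟨ atDiff-cong m j (λ m′ _ → sym (mass-∷ b s k m′)) ⟩
    atDiff (mass b s (suc k)) m j                                         ∎

mass-recurrence : ∀ b t k m → m ≤ b →
  ℕ→ℚ m *ℚ mass b (suc t) k m ≡ ∑[ i < k ] atDiff (mass b (suc t) k) m (toℕ i + suc t)
mass-recurrence b t zero    zero    _   = ℚ.*-zeroˡ (mass b (suc t) 0 0)
mass-recurrence b t zero    (suc m) _   = ℚ.*-zeroʳ (ℕ→ℚ (suc m))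
mass-recurrence b t (suc k) m       m≤b = begin
  ℕ→ℚ m *ℚ M m                                                     ≡⟨ cong (ℕ→ℚ m *ℚ_) (mass-∷ b s k m) ⟩
  ℕ→ℚ m *ℚ ∑[ x < suc b ] (c x *ℚ tail-mass x)                             ≡⟨ *-distribˡ-sum {suc b} (ℕ→ℚ m) (λ x → c x *ℚ tail-mass x) ⟩
  ∑[ x < suc b ] (ℕ→ℚ m *ℚ (c x *ℚ tail-mass x))                           ≡⟨ sum-cong-≗ {suc b} (λ x → ℕ→ℚ-*-atDiff (c x) M′ m (s * toℕ x)) ⟩
  ∑[ x < suc b ] (c x *ℚ (ℕ→ℚ (m ∸ s * toℕ x) *ℚ tail-mass x) +ℚ (ℕ→ℚ (s * toℕ x) *ℚ c x) *ℚ tail-mass x)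
                                                                   ≡⟨ ∑-distrib-+ {suc b} (λ x → c x *ℚ (ℕ→ℚ (m ∸ s * toℕ x) *ℚ tail-mass x)) (λ x → (ℕ→ℚ (s * toℕ x) *ℚ c x) *ℚ tail-mass x) ⟩
  ∑[ x < suc b ] (c x *ℚ (ℕ→ℚ (m ∸ s * toℕ x) *ℚ tail-mass x)) +ℚ ∑[ x < suc b ] ((ℕ→ℚ (s * toℕ x) *ℚ c x) *ℚ tail-mass x)
                                                                   ≡⟨ cong₂ _+ℚ_ (otherLengths-contribution b s k m m≤b (λ m′ → mass-recurrence b s k m′))
                                                                                (firstLength-contribution b t k m m≤b) ⟩
  ∑[ i < k ] atDiff M m (toℕ i + suc s) +ℚ atDiff M m s            ≡⟨ ℚ.+-comm (∑[ i < k ] atDiff M m (toℕ i + suc s)) (atDiff M m s) ⟩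
  atDiff M m s +ℚ ∑[ i < k ] atDiff M m (toℕ i + suc s)            ≡⟨ cong (atDiff M m s +ℚ_) (sum-cong-≗ {k} (λ i → cong (atDiff M m) (ℕ.+-suc (toℕ i) s))) ⟩
  atDiff M m s +ℚ ∑[ i < k ] atDiff M m (suc (toℕ i) + s)          ∎
  where
  open ≡-Reasoning
  s : ℕ
  s = suc t
  M : ℕ → ℚ
  M = mass b s (suc k)
  M′ : ℕ → ℚ
  M′ = mass b (suc s) k
  c : Fin (suc b) → ℚ
  c x = cycleFactor s (toℕ x)
  tail-mass : Fin (suc b) → ℚ
  tail-mass x = atDiff M′ m (s * toℕ x)

mass≤1 : ∀ b t k m → m ≤ b → mass b (suc t) k m ≤ℚ 1ℚ
mass≤1 b t k = <-rec (λ m → m ≤ b → M m ≤ℚ 1ℚ) step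
  where
  s : ℕ
  s = suc t
  M : ℕ → ℚ
  M = mass b s k
  step : ∀ m → (∀ {m′} → m′ < m → m′ ≤ b → M m′ ≤ℚ 1ℚ) → m ≤ b → M m ≤ℚ 1ℚ
  step zero    _  _   = ℚ.≤-reflexive (mass-zero b t k)
  step (suc m) ih m≤b = ℕ→ℚ-*-≤-cancel (suc m) (begin
    ℕ→ℚ (suc m) *ℚ M (suc m)                      ≡⟨ mass-recurrence b t k (suc m) m≤b ⟩
    ∑[ i < k ] atDiff M (suc m) (toℕ i + s)       ≤⟨ ∑-≤-support {k} (λ i → atDiff M (suc m) (toℕ i + s)) (suc m)
                                                         (λ i → term≤1 (toℕ i)) (λ i → term-vanishes (toℕ i)) ⟩
    ℕ→ℚ (suc m)                                   ∎)
    where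
    open ℚ.≤-Reasoning
    term≤1 : ∀ i → atDiff M (suc m) (i + s) ≤ℚ 1ℚ
    term≤1 i with i + s ≤? suc m
    ... | yes i+s≤m = ih (ℕ.∸-monoʳ-< {o = 0} (ℕ.≤-trans (s≤s z≤n) (ℕ.m≤n+m s i)) i+s≤m) (ℕ.≤-trans (ℕ.m∸n≤m (suc m) (i + s)) m≤b)
    ... | no _      = ℚ.nonNegative⁻¹ 1ℚ
    term-vanishes : ∀ i → suc m ≤ i → atDiff M (suc m) (i + s) ≡ 0ℚ
    term-vanishes i m<i with i + s ≤? suc m
    ... | yes i+s≤m = ⊥-elim (ℕ.<⇒≱ (ℕ.<-≤-trans (ℕ.m<m+n i (s≤s z≤n)) i+s≤m) m<i)
    ... | no _      = refl

p≡1/ℕ-denFrom : ∀ {k} (v : Vec ℕ k) → p v ≡ 1/ℕ (denFrom 1 v)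
p≡1/ℕ-denFrom v = 1/-≡-1/ℕ (denFrom 1 v) {{denFrom≢0 1 v}}

p-nonNeg : ∀ {k} (v : Vec ℕ k) → 0ℚ ≤ℚ p v
p-nonNeg v = subst (0ℚ ≤ℚ_) (sym (p≡1/ℕ-denFrom v)) (1/ℕ-nonNeg (denFrom 1 v))

∑p≤1 : ∀ n → sumℚ (map p (partitions n)) ≤ℚ 1ℚ
∑p≤1 n = begin
  sumℚ (map p (partitions n))                                        ≡⟨ sumℚ-filter (λ v → weight v ≟ n) p (boundedVecs n n) ⟩
  sumℚ (map (λ v → when (weight v ≟ n) (p v)) (boundedVecs n n))    ≡⟨ cong sumℚ (List.map-cong (λ v → cong (when (weight v ≟ n)) (p≡1/ℕ-denFrom v)) (boundedVecs n n)) ⟩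
  mass n 1 n n                                                       ≤⟨ mass≤1 n 0 n n ℕ.≤-refl ⟩
  1ℚ                                                                 ∎
  where open ℚ.≤-Reasoning

2^n≤2*n! : ∀ n → 2 ^ n ≤ 2 * n !
2^n≤2*n! zero          = s≤s z≤n
2^n≤2*n! (suc zero)    = ℕ.≤-refl
2^n≤2*n! (suc (suc n)) =
  ℕ.*-monoʳ-≤ 2 (ℕ.≤-trans (2^n≤2*n! (suc n)) (ℕ.*-monoˡ-≤ (suc n !) {2} {suc (suc n)} (s≤s (s≤s z≤n))))

2^ω≤denFrom : ∀ s → 2 ≤ s → ∀ {k} (v : Vec ℕ k) → 2 ^ ω v ≤ denFrom s v
2^ω≤denFrom s 2≤s []      = ℕ.≤-refl
2^ω≤denFrom s 2≤s (x ∷ v) = begin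
  2 ^ (x + ω v)                  ≡⟨ ℕ.^-distribˡ-+-* 2 x (ω v) ⟩
  2 ^ x * 2 ^ ω v                ≤⟨ ℕ.*-mono-≤ (ℕ.^-monoˡ-≤ x 2≤s) (2^ω≤denFrom (suc s) (ℕ.m≤n⇒m≤1+n 2≤s) v) ⟩
  s ^ x * denFrom (suc s) v      ≤⟨ ℕ.*-monoˡ-≤ (denFrom (suc s) v) (ℕ.m≤m*n (s ^ x) (x !) {{ℕ._!≢0 x}}) ⟩
  s ^ x * x ! * denFrom (suc s) v ∎
  where open ℕ.≤-Reasoning

2^ω≤2*denFrom1 : ∀ {k} (v : Vec ℕ k) → 2 ^ ω v ≤ 2 * denFrom 1 v
2^ω≤2*denFrom1 []      = s≤s z≤n
2^ω≤2*denFrom1 (x ∷ v) = begin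
  2 ^ (x + ω v)                      ≡⟨ ℕ.^-distribˡ-+-* 2 x (ω v) ⟩
  2 ^ x * 2 ^ ω v                    ≤⟨ ℕ.*-mono-≤ (2^n≤2*n! x) (2^ω≤denFrom 2 ℕ.≤-refl v) ⟩
  2 * x ! * denFrom 2 v              ≡⟨ ℕ-solve 3 (λ a f d → (a :× f) :× d :=ℕ a :× ((ℕ-con 1 :× f) :× d)) refl 2 (x !) (denFrom 2 v) ⟩
  2 * (1 * x ! * denFrom 2 v)        ≡⟨ cong (λ u → 2 * (u * x ! * denFrom 2 v)) (ℕ.^-zeroˡ x) ⟨
  2 * (1 ^ x * x ! * denFrom 2 v)    ∎
  where open ℕ.≤-Reasoning

2N<2^ω⇒p^suc≤ : ∀ N .{{_ : NonZero N}} r {k} (v : Vec ℕ k) → 2 * N < 2 ^ ω v → p v ^ℚ suc r ≤ℚ 1/ℕ (N ^ r) *ℚ p v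
2N<2^ω⇒p^suc≤ N r v 2N<2^ω = begin
  p v *ℚ p v ^ℚ r          ≤⟨ ℚ.*-monoˡ-≤-nonNeg (p v) {{nonNegative (p-nonNeg v)}} (^ℚ-monoˡ-≤ r (p-nonNeg v) p≤1/N) ⟩
  p v *ℚ 1/ℕ N ^ℚ r        ≡⟨ cong (p v *ℚ_) (1/ℕ-^ N r) ⟩
  p v *ℚ 1/ℕ (N ^ r)       ≡⟨ ℚ.*-comm (p v) _ ⟩
  1/ℕ (N ^ r) *ℚ p v       ∎
  where
  open ℚ.≤-Reasoning
  N<den : N < denFrom 1 v
  N<den = ℕ.*-cancelˡ-< 2 N (denFrom 1 v) (ℕ.<-≤-trans 2N<2^ω (2^ω≤2*denFrom1 v))
  p≤1/N : p v ≤ℚ 1/ℕ N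
  p≤1/N = subst (_≤ℚ 1/ℕ N) (sym (p≡1/ℕ-denFrom v)) (1/ℕ-antimono (ℕ.<⇒≤ N<den))

∑p^suc≤ : ∀ N .{{_ : NonZero N}} r n →
  sumℚ (map (λ v → p v ^ℚ suc r) (filter (λ v → 2 * N <? 2 ^ ω v) (partitions n))) ≤ℚ 1/ℕ (N ^ r)
∑p^suc≤ N r n = begin
  sumℚ (map (λ v → p v ^ℚ suc r) (filter many? (partitions n)))      ≡⟨ sumℚ-filter many? (λ v → p v ^ℚ suc r) (partitions n) ⟩
  sumℚ (map (λ v → when (many? v) (p v ^ℚ suc r)) (partitions n))    ≤⟨ sumℚ-mono termwise (partitions n) ⟩
  sumℚ (map (λ v → 1/ℕ (N ^ r) *ℚ p v) (partitions n))               ≡⟨ sumℚ-*ˡ p (1/ℕ (N ^ r)) (partitions n) ⟩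
  1/ℕ (N ^ r) *ℚ sumℚ (map p (partitions n))                         ≤⟨ ℚ.*-monoˡ-≤-nonNeg (1/ℕ (N ^ r)) {{nonNegative (1/ℕ-nonNeg (N ^ r))}} (∑p≤1 n) ⟩
  1/ℕ (N ^ r) *ℚ 1ℚ                                                  ≡⟨ ℚ.*-identityʳ _ ⟩
  1/ℕ (N ^ r)                                                        ∎
  where
  open ℚ.≤-Reasoning
  many? : ∀ {k} (v : Vec ℕ k) → Dec (2 * N < 2 ^ ω v)
  many? v = 2 * N <? 2 ^ ω v
  termwise : ∀ v → when (many? v) (p v ^ℚ suc r) ≤ℚ 1/ℕ (N ^ r) *ℚ p v
  termwise v with many? v
  ... | yes 2N<2^ω = 2N<2^ω⇒p^suc≤ N r v 2N<2^ω
  ... | no _       = *-nonNeg (1/ℕ-nonNeg (N ^ r)) (p-nonNeg v)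

-- ω(λ) > log₂(2n³) is encoded as 2n³ < 2^ω(λ), equivalent as ω(λ) is an integer.
lemmaA1 : (r : ℕ) → 2 ≤ r → (n : ℕ) → .{{nz : NonZero n}} →
    sumℚ (map (λ v → p v ^ℚ r) (filter (λ v → 2 * n ^ 3 <? 2 ^ ω v) (partitions n)))
      ≤ℚ ((+ 1) / (n ^ (3 * (r ∸ 1)))) {{m^n≢0 n (3 * (r ∸ 1))}}
lemmaA1 (suc zero)    (s≤s ()) n
lemmaA1 (suc (suc r)) _        n = begin
  sumℚ (map (λ v → p v ^ℚ suc (suc r)) (filter (λ v → 2 * n ^ 3 <? 2 ^ ω v) (partitions n)))
                                ≤⟨ ∑p^suc≤ (n ^ 3) {{m^n≢0 n 3}} (suc r) n ⟩
  1/ℕ ((n ^ 3) ^ suc r)         ≡⟨ cong 1/ℕ (ℕ.^-*-assoc n 3 (suc r)) ⟩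
  1/ℕ (n ^ (3 * suc r))         ≡⟨ 1/-≡-1/ℕ (n ^ (3 * suc r)) {{m^n≢0 n (3 * suc r)}} ⟨
  (+ 1 / n ^ (3 * suc r)) {{m^n≢0 n (3 * suc r)}} ∎
  where open ℚ.≤-Reasoning
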